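{- For every $\mathbf k\in(\mathbb N\cup\{\infty\})^\ell$, the linear functional $\nu_{\mathcal Q}^{\mathbf k}$ on $\mathrm{QSym}^{(\ell)}$ is $\mathbf k$-odd.
   Context: Fix $\ell\ge1$; $|\mathbf n|=\sum n_i$, coordinatewise order on $(\mathbb N\cup\{\infty\})^\ell$. $\mathrm{QSym}^{(\ell)}$ is the $\mathbb Q$-span of $M_{\mathbf I}=\sum_{j_1<\dots<j_m}\mathbf x_{j_1}^{\mathbf i_1}\cdots\mathbf x_{j_m}^{\mathbf i_m}$ over vector compositions (sequences of nonzero elements of $\mathbb N^\ell$) in commuting variables $x_j^{(i)}$ ($\mathbf x_j^{\mathbf n}=\prod_i(x_j^{(i)})^{n_i}$), an $\mathbb N^\ell$-graded connected Hopf algebra with product of power series, deconcatenation coproduct and antipode $\mathsf S_{\mathcal Q}$. $\zeta_{\mathcal Q}(M_{\mathbf I})=1$ if $\mathbf I$ has length $\le1$, else $0$. For a functional $\phi$, $\phi_{\mathbf n}$ is its restriction to degree $\mathbf n$ and $\bar\phi(h)=(-1)^{|\mathbf n|}\phi(h)$ for $h$ of degree $\mathbf n$; convolution is $\phi\psi=m\circ(\phi\otimes\psi)\circ\Delta$ and $\phi^{ -1}$ is the convolution inverse. Define $\zeta_{\mathcal Q}^{\mathbf k}$ by $(\zeta_{\mathcal Q}^{\mathbf k})_{\mathbf n}=(\bar\zeta_{\mathcal Q})_{\mathbf n}$ if $\mathbf n\le\mathbf k$ and $=(\zeta_{\mathcal Q})_{\mathbf n}$ otherwise, and $\nu_{\mathcal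 Q}^{\mathbf k}=(\zeta_{\mathcal Q}^{\mathbf k}\circ\mathsf S_{\mathcal Q})\,\zeta_{\mathcal Q}$ (convolution). An invertible linear functional $\phi$ is $\mathbf k$-odd if $(\bar\phi)_{\mathbf n}=(\phi^{ -1})_{\mathbf n}$ for all $\mathbf n\in\mathbb N^\ell$ with $\mathbf n\le\mathbf k$. -}

module Defs where

open import Data.Nat as ℕ using (ℕ; zero; suc; _≤_)
import Data.Nat.Properties as ℕP
open import Data.Rational as ℚ using (ℚ; 0ℚ; 1ℚ)
open import Data.Vec as V using (Vec; zipWith; replicate)
open import Data.Vec.Relation.Unary.Any using (Any; here; there)
open import Data.Vec.Relation.Binary.Pointwise.Inductive as PW using (Pointwise)
open import Data.List as L using (List; []; _∷_; _++_; [_]; concatMap; length)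
open import Data.Product using (Σ; _×_; _,_; proj₁; proj₂; Σ-syntax)
open import Relation.Nullary using (Dec; yes; no)
open import Relation.Binary.PropositionalEquality using (_≡_)

data ℕ∞ : Set where
  fin : ℕ → ℕ∞
  ∞   : ℕ∞

data _≤∞_ : ℕ → ℕ∞ → Set where
  fin≤ : ∀ {m n} → m ≤ n → m ≤∞ fin n
  ≤∞∞  : ∀ {m} → m ≤∞ ∞

_≤∞?_ : (m : ℕ) (k : ℕ∞) → Dec (m ≤∞ k)
m ≤∞? fin n with m ℕ.≤? n
... | yes p = yes (fin≤ p)
... | no ¬p = no λ { (fin≤ p) → ¬p p }
m ≤∞? ∞ = yes ≤∞∞

_≤ᵛ_ : ∀ {ℓ} → Vec ℕ ℓ → Vec ℕ∞ ℓ → Set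
n ≤ᵛ k = Pointwise _≤∞_ n k

_≤ᵛ?_ : ∀ {ℓ} (n : Vec ℕ ℓ) (k : Vec ℕ∞ ℓ) → Dec (n ≤ᵛ k)
n ≤ᵛ? k = PW.decidable _≤∞?_ n k

Positive : ℕ → Set
Positive x = 1 ≤ x

Letter : ℕ → Set
Letter ℓ = Σ[ v ∈ Vec ℕ ℓ ] Any Positive v

nz+ : ∀ {ℓ} (a b : Vec ℕ ℓ) → Any Positive a → Any Positive (zipWith ℕ._+_ a b)
nz+ (x V.∷ a) (y V.∷ b) (here px) = here (ℕP.≤-trans px (ℕP.m≤m+n x y))
nz+ (x V.∷ a) (y V.∷ b) (there p) = there (nz+ a b p)

_⊕_ : ∀ {ℓ} → Letter ℓ → Letter ℓ → Letter ℓ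
(a , pa) ⊕ (b , _) = zipWith ℕ._+_ a b , nz+ a b pa

VComp : ℕ → Set
VComp ℓ = List (Letter ℓ)

deg : ∀ {ℓ} → VComp ℓ → Vec ℕ ℓ
deg {ℓ} = L.foldr (λ a n → zipWith ℕ._+_ (proj₁ a) n) (replicate ℓ 0)

∣_∣ : ∀ {ℓ} → Vec ℕ ℓ → ℕ
∣ n ∣ = V.sum n

sign : ℕ → ℚ
sign zero    = 1ℚ
sign (suc m) = ℚ.- sign m

-- QSym^(ℓ): elements are finite formal ℚ-linear combinations of the
-- basis elements M_I (not normalised; only ever fed to linear maps).

LinComb : ℕ → Set
LinComb ℓ = List (ℚ × VComp ℓ)

-- Product of monomial quasisymmetric functions M_I · M_J (product of
-- power series) = sum over quasi-shuffles (stuffles) of I and J.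
stuffle : ∀ {ℓ} → VComp ℓ → VComp ℓ → List (VComp ℓ)
stuffle [] v = [ v ]
stuffle (a ∷ u) [] = [ a ∷ u ]
stuffle (a ∷ u) (b ∷ v) =
  L.map (a ∷_) (stuffle u (b ∷ v)) ++
  (L.map (b ∷_) (stuffle (a ∷ u) v) ++
   L.map ((a ⊕ b) ∷_) (stuffle u v))

mulM : ∀ {ℓ} → VComp ℓ → LinComb ℓ → LinComb ℓ
mulM P X = concatMap (λ cK → L.map (λ J → (proj₁ cK , J)) (stuffle P (proj₂ cK))) X

negLC : ∀ {ℓ} → LinComb ℓ → LinComb ℓ
negLC = L.map (λ cK → (ℚ.- proj₁ cK , proj₂ cK))

-- Antipode S_Q on the basis, determined by the defining identity
-- m ∘ (id ⊗ S) ∘ Δ = u ∘ ε with the deconcatenation coproduct: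
--   S(M_∅) = 1,  S(M_I) = - Σ_{I = J·K, J ≠ ∅} M_J · S(M_K)   (I ≠ ∅).
mutual
  antipode : ∀ {ℓ} → VComp ℓ → LinComb ℓ
  antipode [] = [ (1ℚ , []) ]
  antipode (a ∷ r) = negLC (antipodeAux [ a ] r)

  -- Σ over splittings r = p' · q of  M_{P · p'} · S(M_q)
  antipodeAux : ∀ {ℓ} → VComp ℓ → VComp ℓ → LinComb ℓ
  antipodeAux P [] = mulM P (antipode [])
  antipodeAux P (b ∷ q) = mulM P (antipode (b ∷ q)) ++ antipodeAux (P ++ [ b ]) q

-- Linear functionals on QSym^(ℓ), given by their values on the basis M_I.

Functional : ℕ → Set
Functional ℓ = VComp ℓ → ℚ

eval : ∀ {ℓ} → Functional ℓ → LinComb ℓ → ℚ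
eval φ X = L.foldr (λ cK s → proj₁ cK ℚ.* φ (proj₂ cK) ℚ.+ s) 0ℚ X

_∘S : ∀ {ℓ} → Functional ℓ → Functional ℓ
(φ ∘S) I = eval φ (antipode I)

deconcat : ∀ {ℓ} → VComp ℓ → List (VComp ℓ × VComp ℓ)
deconcat [] = [ ([] , []) ]
deconcat (a ∷ r) = ([] , a ∷ r) ∷ L.map (λ JK → (a ∷ proj₁ JK , proj₂ JK)) (deconcat r)

_⋆_ : ∀ {ℓ} → Functional ℓ → Functional ℓ → Functional ℓ
(φ ⋆ ψ) I = L.foldr (λ JK s → φ (proj₁ JK) ℚ.* ψ (proj₂ JK) ℚ.+ s) 0ℚ (deconcat I)

ε : ∀ {ℓ} → Functional ℓ
ε [] = 1ℚ
ε (_ ∷ _) = 0ℚ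

IsConvInverse : ∀ {ℓ} → Functional ℓ → Functional ℓ → Set
IsConvInverse φ ψ = (∀ I → (φ ⋆ ψ) I ≡ ε I) × (∀ I → (ψ ⋆ φ) I ≡ ε I)

bar : ∀ {ℓ} → Functional ℓ → Functional ℓ
bar φ I = sign ∣ deg I ∣ ℚ.* φ I

-- φ is invertible and k-odd: (φ̄)_n = (φ⁻¹)_n for all n ∈ ℕ^ℓ, n ≤ k.
-- (The convolution inverse is unique, so "there is an inverse ψ with ..."
-- is the same as "φ is invertible and φ⁻¹ satisfies ...".)
IsOdd : ∀ {ℓ} → Vec ℕ∞ ℓ → Functional ℓ → Set
IsOdd {ℓ} k φ = Σ[ ψ ∈ Functional ℓ ]
  (IsConvInverse φ ψ × (∀ I → deg I ≤ᵛ k → bar φ I ≡ ψ I))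

ζQ : ∀ {ℓ} → Functional ℓ
ζQ [] = 1ℚ
ζQ (_ ∷ []) = 1ℚ
ζQ (_ ∷ _ ∷ _) = 0ℚ

ζQ^ : ∀ {ℓ} → Vec ℕ∞ ℓ → Functional ℓ
ζQ^ k I with deg I ≤ᵛ? k
... | yes _ = bar ζQ I
... | no _  = ζQ I

νQ^ : ∀ {ℓ} → Vec ℕ∞ ℓ → Functional ℓ
νQ^ k = (ζQ^ k ∘S) ⋆ ζQ

module Submission where

-- Write ζ̄ = bar ζQ and let S be the antipode.  Since
-- ζ and ζ̄ are characters (multiplicative for the stuffle product, value
-- 1 on M_∅), φ ∘ S is the convolution inverse of φ for φ ∈ {ζ, ζ̄}.  The
-- antipode preserves the ℕ^ℓ-degree, so on compositions of degree ≤ k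
-- the functional ν = (ζ^k ∘ S) ζ agrees with ν∞ = ζ̄⁻¹ ζ, and since the
-- deconcatenation coproduct only splits I into pieces of smaller degree,
-- every convolution identity restricts to degrees ≤ k.  Now ν∞ is odd
-- everywhere: the sign twist φ ↦ φ̄ is a convolution automorphism
-- commuting with S, so the twist of ν∞ = ζ̄⁻¹ζ is ζ⁻¹ζ̄ = ν∞⁻¹.
-- Consequently, below k, ν̄ = ν̄∞ = ν∞⁻¹ = ν⁻¹.

open import Defs
open import Algebra.Bundles using (CommutativeSemigroup)
import Algebra.Properties.CommutativeSemigroup as CommutativeSemigroupProperties
open import Data.Nat as ℕ using (ℕ; zero; suc)
import Data.Nat.Properties as ℕP
open import Data.Rational using (ℚ; 0ℚ; 1ℚ; _+_; _*_; -_)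
open import Data.Rational.Properties using (+-identityˡ; +-identityʳ; +-assoc; *-identityˡ; *-zeroˡ; *-zeroʳ; *-distribˡ-+)
open import Data.Rational.Solver using (module +-*-Solver)
open +-*-Solver using (solve; _:+_; _:*_; :-_; _:=_; con)
open import Data.Vec as V using (Vec; zipWith; replicate)
import Data.Vec.Properties as VP
import Data.Vec.Relation.Binary.Pointwise.Inductive as PW
open import Data.List as L using (List; []; _∷_; _++_; [_])
open import Data.List.Properties using (++-assoc; ++-identityʳ)
open import Data.List.Relation.Unary.All as All using (All; []; _∷_)
open import Data.List.Relation.Unary.All.Properties using (map⁺; ++⁺)
open import Level using (0ℓ)
open import Data.Product using (_×_; _,_; proj₁; proj₂)
open import Relation.Nullary using (yes; no)
open import Data.Empty using (⊥-elim)
open import Relation.Binary.PropositionalEquality hiding ([_])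
open import Relation.Binary.PropositionalEquality.Algebra using (isMagma)
open ≡-Reasoning

∑ : {A : Set} → List A → (A → ℚ) → ℚ
∑ xs f = L.foldr (λ x s → f x + s) 0ℚ xs

module _ {A : Set} where

  ∑-map : {B : Set} (h : A → B) (xs : List A) (f : B → ℚ) →
          ∑ (L.map h xs) f ≡ ∑ xs (λ x → f (h x))
  ∑-map h [] f = refl
  ∑-map h (x ∷ xs) f = cong (f (h x) +_) (∑-map h xs f)

  ∑-++ : (xs ys : List A) (f : A → ℚ) → ∑ (xs ++ ys) f ≡ ∑ xs f + ∑ ys f
  ∑-++ [] ys f = sym (+-identityˡ (∑ ys f))
  ∑-++ (x ∷ xs) ys f = begin
    f x + ∑ (xs ++ ys) f       ≡⟨ cong (f x +_) (∑-++ xs ys f) ⟩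
    f x + (∑ xs f + ∑ ys f)    ≡⟨ sym (+-assoc (f x) (∑ xs f) (∑ ys f)) ⟩
    (f x + ∑ xs f) + ∑ ys f    ∎

  ∑-congᴬ : {xs : List A} {f g : A → ℚ} → All (λ x → f x ≡ g x) xs → ∑ xs f ≡ ∑ xs g
  ∑-congᴬ [] = refl
  ∑-congᴬ (p ∷ ps) = cong₂ _+_ p (∑-congᴬ ps)

  ∑-cong : (xs : List A) {f g : A → ℚ} → f ≗ g → ∑ xs f ≡ ∑ xs g
  ∑-cong xs f≗g = ∑-congᴬ (All.universal f≗g xs)

  ∑-zero : (xs : List A) (f : A → ℚ) → (∀ x → f x ≡ 0ℚ) → ∑ xs f ≡ 0ℚ
  ∑-zero [] f f≡0 = refl
  ∑-zero (x ∷ xs) f f≡0 = cong₂ _+_ (f≡0 x) (∑-zero xs f f≡0)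

  ∑-+ : (xs : List A) (f g : A → ℚ) → ∑ xs (λ x → f x + g x) ≡ ∑ xs f + ∑ xs g
  ∑-+ [] f g = refl
  ∑-+ (x ∷ xs) f g = begin
    (f x + g x) + ∑ xs (λ x → f x + g x)  ≡⟨ cong ((f x + g x) +_) (∑-+ xs f g) ⟩
    (f x + g x) + (∑ xs f + ∑ xs g)       ≡⟨ solve 4 (λ a b c d → (a :+ b) :+ (c :+ d) := (a :+ c) :+ (b :+ d)) refl (f x) (g x) (∑ xs f) (∑ xs g) ⟩
    (f x + ∑ xs f) + (g x + ∑ xs g)       ∎

  ∑-*ˡ : (c : ℚ) (xs : List A) (f : A → ℚ) → ∑ xs (λ x → c * f x) ≡ c * ∑ xs f
  ∑-*ˡ c [] f = sym (*-zeroʳ c)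
  ∑-*ˡ c (x ∷ xs) f = begin
    c * f x + ∑ xs (λ x → c * f x)  ≡⟨ cong (c * f x +_) (∑-*ˡ c xs f) ⟩
    c * f x + c * ∑ xs f            ≡⟨ sym (*-distribˡ-+ c (f x) (∑ xs f)) ⟩
    c * (f x + ∑ xs f)              ∎

module _ {ℓ : ℕ} where

  private
    F : Set
    F = Functional ℓ

  ∂ : Letter ℓ → F → F
  ∂ a φ I = φ (a ∷ I)

  deconcat-splits : (I : VComp ℓ) → All (λ JK → proj₁ JK ++ proj₂ JK ≡ I) (deconcat I)
  deconcat-splits [] = refl ∷ []
  deconcat-splits (a ∷ r) = refl ∷ map⁺ (All.map (cong (a ∷_)) (deconcat-splits r))

  -- Splitting off the empty prefix: (φψ)(a·r) = φ(∅) ψ(a·r) + ((∂_a φ) ψ)(r).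
  -- All convolution identities below are proved by induction along this.
  ⋆-cons : (φ ψ : F) (a : Letter ℓ) (r : VComp ℓ) →
           (φ ⋆ ψ) (a ∷ r) ≡ φ [] * ψ (a ∷ r) + (∂ a φ ⋆ ψ) r
  ⋆-cons φ ψ a r = cong (φ [] * ψ (a ∷ r) +_)
    (∑-map (λ JK → (a ∷ proj₁ JK , proj₂ JK)) (deconcat r) (λ JK → φ (proj₁ JK) * ψ (proj₂ JK)))

  ⋆-congˡ : {φ φ′ : F} (ψ : F) → φ ≗ φ′ → φ ⋆ ψ ≗ φ′ ⋆ ψ
  ⋆-congˡ ψ φ≗φ′ I = ∑-cong (deconcat I) (λ JK → cong (_* ψ (proj₂ JK)) (φ≗φ′ (proj₁ JK)))

  ⋆-congʳ : (φ : F) {ψ ψ′ : F} → ψ ≗ ψ′ → φ ⋆ ψ ≗ φ ⋆ ψ′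
  ⋆-congʳ φ ψ≗ψ′ I = ∑-cong (deconcat I) (λ JK → cong (φ (proj₁ JK) *_) (ψ≗ψ′ (proj₂ JK)))

  ⋆-linearˡ : (c : ℚ) (f g χ : F) → (λ J → c * f J + g J) ⋆ χ ≗ (λ I → c * (f ⋆ χ) I + (g ⋆ χ) I)
  ⋆-linearˡ c f g χ I = begin
    ∑ (deconcat I) (λ JK → (c * f (proj₁ JK) + g (proj₁ JK)) * χ (proj₂ JK))
      ≡⟨ ∑-cong (deconcat I) (λ JK → solve 4 (λ c x y z → (c :* x :+ y) :* z := c :* (x :* z) :+ y :* z) refl c (f (proj₁ JK)) (g (proj₁ JK)) (χ (proj₂ JK))) ⟩
    ∑ (deconcat I) (λ JK → c * (f (proj₁ JK) * χ (proj₂ JK)) + g (proj₁ JK) * χ (proj₂ JK))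
      ≡⟨ ∑-+ (deconcat I) (λ JK → c * (f (proj₁ JK) * χ (proj₂ JK))) (λ JK → g (proj₁ JK) * χ (proj₂ JK)) ⟩
    ∑ (deconcat I) (λ JK → c * (f (proj₁ JK) * χ (proj₂ JK))) + (g ⋆ χ) I
      ≡⟨ cong (_+ (g ⋆ χ) I) (∑-*ˡ c (deconcat I) _) ⟩
    c * (f ⋆ χ) I + (g ⋆ χ) I ∎

  ⋆-assoc : (φ ψ χ : F) → (φ ⋆ ψ) ⋆ χ ≗ φ ⋆ (ψ ⋆ χ)
  ⋆-assoc φ ψ χ [] = solve 3 (λ a b c → (a :* b :+ con 0ℚ) :* c :+ con 0ℚ := a :* (b :* c :+ con 0ℚ) :+ con 0ℚ) refl (φ []) (ψ []) (χ [])
  ⋆-assoc φ ψ χ (a ∷ r) = begin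
      ((φ ⋆ ψ) ⋆ χ) (a ∷ r)
    ≡⟨ ⋆-cons (φ ⋆ ψ) χ a r ⟩
      φψ₀ * χ (a ∷ r) + (∂ a (φ ⋆ ψ) ⋆ χ) r
    ≡⟨ cong (φψ₀ * χ (a ∷ r) +_) (⋆-congˡ χ (⋆-cons φ ψ a) r) ⟩
      φψ₀ * χ (a ∷ r) + ((λ J → φ [] * ∂ a ψ J + (∂ a φ ⋆ ψ) J) ⋆ χ) r
    ≡⟨ cong (φψ₀ * χ (a ∷ r) +_) (⋆-linearˡ (φ []) (∂ a ψ) (∂ a φ ⋆ ψ) χ r) ⟩
      φψ₀ * χ (a ∷ r) + (φ [] * (∂ a ψ ⋆ χ) r + ((∂ a φ ⋆ ψ) ⋆ χ) r)
    ≡⟨ cong (λ x → φψ₀ * χ (a ∷ r) + (φ [] * (∂ a ψ ⋆ χ) r + x)) (⋆-assoc (∂ a φ) ψ χ r) ⟩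
      (φ [] * ψ [] + 0ℚ) * χ (a ∷ r) + (φ [] * (∂ a ψ ⋆ χ) r + (∂ a φ ⋆ (ψ ⋆ χ)) r)
    ≡⟨ solve 5 (λ p q c x y → (p :* q :+ con 0ℚ) :* c :+ (p :* x :+ y) := p :* (q :* c :+ x) :+ y) refl
         (φ []) (ψ []) (χ (a ∷ r)) ((∂ a ψ ⋆ χ) r) ((∂ a φ ⋆ (ψ ⋆ χ)) r) ⟩
      φ [] * (ψ [] * χ (a ∷ r) + (∂ a ψ ⋆ χ) r) + (∂ a φ ⋆ (ψ ⋆ χ)) r
    ≡⟨ cong (λ x → φ [] * x + (∂ a φ ⋆ (ψ ⋆ χ)) r) (sym (⋆-cons ψ χ a r)) ⟩
      φ [] * (ψ ⋆ χ) (a ∷ r) + (∂ a φ ⋆ (ψ ⋆ χ)) r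
    ≡⟨ sym (⋆-cons φ (ψ ⋆ χ) a r) ⟩
      (φ ⋆ (ψ ⋆ χ)) (a ∷ r) ∎
    where
    φψ₀ : ℚ
    φψ₀ = (φ ⋆ ψ) []

  ε-unitˡ : (φ : F) → ε ⋆ φ ≗ φ
  ε-unitˡ φ [] = solve 1 (λ x → con 1ℚ :* x :+ con 0ℚ := x) refl (φ [])
  ε-unitˡ φ (a ∷ r) = begin
    (ε ⋆ φ) (a ∷ r)                 ≡⟨ ⋆-cons ε φ a r ⟩
    1ℚ * φ (a ∷ r) + (∂ a ε ⋆ φ) r  ≡⟨ cong (1ℚ * φ (a ∷ r) +_) (∑-zero (deconcat r) _ (λ JK → *-zeroˡ (φ (proj₂ JK)))) ⟩
    1ℚ * φ (a ∷ r) + 0ℚ             ≡⟨ solve 1 (λ x → con 1ℚ :* x :+ con 0ℚ := x) refl (φ (a ∷ r)) ⟩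
    φ (a ∷ r)                       ∎

  ε-unitʳ : (φ : F) → φ ⋆ ε ≗ φ
  ε-unitʳ φ [] = solve 1 (λ x → x :* con 1ℚ :+ con 0ℚ := x) refl (φ [])
  ε-unitʳ φ (a ∷ r) = begin
    (φ ⋆ ε) (a ∷ r)            ≡⟨ ⋆-cons φ ε a r ⟩
    φ [] * 0ℚ + (∂ a φ ⋆ ε) r  ≡⟨ cong (φ [] * 0ℚ +_) (ε-unitʳ (∂ a φ) r) ⟩
    φ [] * 0ℚ + φ (a ∷ r)      ≡⟨ solve 2 (λ y x → y :* con 0ℚ :+ x := x) refl (φ []) (φ (a ∷ r)) ⟩
    φ (a ∷ r)                  ∎

  left≗right-inverse : {φ λ′ ρ : F} → λ′ ⋆ φ ≗ ε → φ ⋆ ρ ≗ ε → λ′ ≗ ρ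
  left≗right-inverse {φ} {λ′} {ρ} left right I = begin
    λ′ I               ≡⟨ sym (ε-unitʳ λ′ I) ⟩
    (λ′ ⋆ ε) I         ≡⟨ ⋆-congʳ λ′ (λ K → sym (right K)) I ⟩
    (λ′ ⋆ (φ ⋆ ρ)) I   ≡⟨ sym (⋆-assoc λ′ φ ρ I) ⟩
    ((λ′ ⋆ φ) ⋆ ρ) I   ≡⟨ ⋆-congˡ ρ left I ⟩
    (ε ⋆ ρ) I          ≡⟨ ε-unitˡ ρ I ⟩
    ρ I                ∎

  ⋆-right-inverse : (φ₁ ψ₁ φ₂ ψ₂ : F) → φ₁ ⋆ ψ₁ ≗ ε → φ₂ ⋆ ψ₂ ≗ ε → (φ₂ ⋆ φ₁) ⋆ (ψ₁ ⋆ ψ₂) ≗ ε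
  ⋆-right-inverse φ₁ ψ₁ φ₂ ψ₂ inv₁ inv₂ I = begin
    ((φ₂ ⋆ φ₁) ⋆ (ψ₁ ⋆ ψ₂)) I   ≡⟨ ⋆-assoc φ₂ φ₁ (ψ₁ ⋆ ψ₂) I ⟩
    (φ₂ ⋆ (φ₁ ⋆ (ψ₁ ⋆ ψ₂))) I   ≡⟨ ⋆-congʳ φ₂ (λ K → sym (⋆-assoc φ₁ ψ₁ ψ₂ K)) I ⟩
    (φ₂ ⋆ ((φ₁ ⋆ ψ₁) ⋆ ψ₂)) I   ≡⟨ ⋆-congʳ φ₂ (⋆-congˡ ψ₂ inv₁) I ⟩
    (φ₂ ⋆ (ε ⋆ ψ₂)) I           ≡⟨ ⋆-congʳ φ₂ (ε-unitˡ ψ₂) I ⟩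
    (φ₂ ⋆ ψ₂) I                 ≡⟨ inv₂ I ⟩
    ε I                         ∎

  right-inverse-by-recursion : (φ ψ : F) → φ [] ≡ 1ℚ → ψ [] ≡ 1ℚ →
    (∀ a r → ψ (a ∷ r) ≡ - (∂ a φ ⋆ ψ) r) → φ ⋆ ψ ≗ ε
  right-inverse-by-recursion φ ψ φ₀ ψ₀ rec [] = cong₂ (λ x y → x * y + 0ℚ) φ₀ ψ₀
  right-inverse-by-recursion φ ψ φ₀ ψ₀ rec (a ∷ r) = begin
    (φ ⋆ ψ) (a ∷ r)                        ≡⟨ ⋆-cons φ ψ a r ⟩
    φ [] * ψ (a ∷ r) + (∂ a φ ⋆ ψ) r       ≡⟨ cong₂ (λ x y → x * y + (∂ a φ ⋆ ψ) r) φ₀ (rec a r) ⟩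
    1ℚ * - (∂ a φ ⋆ ψ) r + (∂ a φ ⋆ ψ) r   ≡⟨ solve 1 (λ x → con 1ℚ :* (:- x) :+ x := con 0ℚ) refl ((∂ a φ ⋆ ψ) r) ⟩
    0ℚ                                     ∎

  -- The recursion "walk along r, moving one letter at a time from the
  -- right factor to the prefix P" computes Σ_{r = J·K} f(P·J) g(K).
  -- Both the inverse below and the antipode of Defs are defined this way.
  splitting-sum : (f g : F) (s : VComp ℓ → VComp ℓ → ℚ) →
    (∀ P → s P [] ≡ f P * g []) →
    (∀ P b q → s P (b ∷ q) ≡ f P * g (b ∷ q) + s (P ++ [ b ]) q) →
    ∀ P r → s P r ≡ ((λ J → f (P ++ J)) ⋆ g) r
  splitting-sum f g s s-[] s-∷ P [] = begin
    s P []                 ≡⟨ s-[] P ⟩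
    f P * g []             ≡⟨ cong (λ Q → f Q * g []) (sym (++-identityʳ P)) ⟩
    f (P ++ []) * g []     ≡⟨ sym (+-identityʳ _) ⟩
    f (P ++ []) * g [] + 0ℚ ∎
  splitting-sum f g s s-[] s-∷ P (b ∷ q) = begin
    s P (b ∷ q)                                                ≡⟨ s-∷ P b q ⟩
    f P * g (b ∷ q) + s (P ++ [ b ]) q                         ≡⟨ cong₂ _+_ (cong (λ Q → f Q * g (b ∷ q)) (sym (++-identityʳ P)))
                                                                            (splitting-sum f g s s-[] s-∷ (P ++ [ b ]) q) ⟩
    f (P ++ []) * g (b ∷ q) + ((λ J → f ((P ++ [ b ]) ++ J)) ⋆ g) q ≡⟨ cong (f (P ++ []) * g (b ∷ q) +_)
                                                                            (⋆-congˡ g (λ J → cong f (++-assoc P [ b ] J)) q) ⟩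
    f (P ++ []) * g (b ∷ q) + (∂ b (λ J → f (P ++ J)) ⋆ g) q  ≡⟨ sym (⋆-cons (λ J → f (P ++ J)) g b q) ⟩
    ((λ J → f (P ++ J)) ⋆ g) (b ∷ q)                           ∎

  -- The convolution inverse of φ, defined by the recursion of
  -- right-inverse-by-recursion; invSplit φ P r is the running sum of
  -- splitting-sum.
  mutual
    inv : F → F
    inv φ [] = 1ℚ
    inv φ (a ∷ r) = - invSplit φ [ a ] r

    invSplit : F → VComp ℓ → VComp ℓ → ℚ
    invSplit φ P [] = φ P * inv φ []
    invSplit φ P (b ∷ q) = φ P * inv φ (b ∷ q) + invSplit φ (P ++ [ b ]) q

  inv-right : (φ : F) → φ [] ≡ 1ℚ → φ ⋆ inv φ ≗ ε
  inv-right φ φ₀ = right-inverse-by-recursion φ (inv φ) φ₀ refl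
    (λ a r → cong -_ (splitting-sum φ (inv φ) (invSplit φ) (λ _ → refl) (λ _ _ _ → refl) [ a ] r))

  -- inv φ is also a left inverse: φ is a left inverse of inv φ, hence equal
  -- to its right inverse inv (inv φ).
  inv-left : (φ : F) → φ [] ≡ 1ℚ → inv φ ⋆ φ ≗ ε
  inv-left φ φ₀ I = begin
    (inv φ ⋆ φ) I              ≡⟨ ⋆-congʳ (inv φ) φ≗inv-inv I ⟩
    (inv φ ⋆ inv (inv φ)) I    ≡⟨ inv-right (inv φ) refl I ⟩
    ε I                        ∎
    where
    φ≗inv-inv : φ ≗ inv (inv φ)
    φ≗inv-inv = left≗right-inverse (inv-right φ φ₀) (inv-right (inv φ) refl)

  inv-inverse : (φ : F) → φ [] ≡ 1ℚ → IsConvInverse φ (inv φ)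
  inv-inverse φ φ₀ = inv-right φ φ₀ , inv-left φ φ₀

  right-inverse⇒left : (φ ρ : F) → φ [] ≡ 1ℚ → φ ⋆ ρ ≗ ε → ρ ⋆ φ ≗ ε
  right-inverse⇒left φ ρ φ₀ right I = begin
    (ρ ⋆ φ) I      ≡⟨ ⋆-congˡ φ (λ J → sym (left≗right-inverse {φ} {inv φ} {ρ} (inv-left φ φ₀) right J)) I ⟩
    (inv φ ⋆ φ) I  ≡⟨ inv-left φ φ₀ I ⟩
    ε I            ∎

_+ᵛ_ : ∀ {n} → Vec ℕ n → Vec ℕ n → Vec ℕ n
_+ᵛ_ = zipWith ℕ._+_

+ᵛ-commutativeSemigroup : ℕ → CommutativeSemigroup 0ℓ 0ℓ
+ᵛ-commutativeSemigroup n = record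
  { Carrier = Vec ℕ n
  ; _≈_ = _≡_
  ; _∙_ = _+ᵛ_
  ; isCommutativeSemigroup = record
    { isSemigroup = record { isMagma = isMagma _+ᵛ_ ; assoc = VP.zipWith-assoc ℕP.+-assoc }
    ; comm = VP.zipWith-comm ℕP.+-comm
    }
  }

module +ᵛ {n : ℕ} = CommutativeSemigroupProperties (+ᵛ-commutativeSemigroup n)

+ᵛ-assoc : ∀ {n} (u v w : Vec ℕ n) → (u +ᵛ v) +ᵛ w ≡ u +ᵛ (v +ᵛ w)
+ᵛ-assoc = VP.zipWith-assoc ℕP.+-assoc

+ᵛ-identityˡ : ∀ {n} (v : Vec ℕ n) → replicate n 0 +ᵛ v ≡ v
+ᵛ-identityˡ = VP.zipWith-identityˡ ℕP.+-identityˡ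

+ᵛ-identityʳ : ∀ {n} (v : Vec ℕ n) → v +ᵛ replicate n 0 ≡ v
+ᵛ-identityʳ = VP.zipWith-identityʳ ℕP.+-identityʳ

∣+ᵛ∣ : ∀ {n} (u v : Vec ℕ n) → ∣ u +ᵛ v ∣ ≡ ∣ u ∣ ℕ.+ ∣ v ∣
∣+ᵛ∣ V.[] V.[] = refl
∣+ᵛ∣ (x V.∷ u) (y V.∷ v) = begin
  (x ℕ.+ y) ℕ.+ ∣ u +ᵛ v ∣         ≡⟨ cong ((x ℕ.+ y) ℕ.+_) (∣+ᵛ∣ u v) ⟩
  (x ℕ.+ y) ℕ.+ (∣ u ∣ ℕ.+ ∣ v ∣)   ≡⟨ +ℕ.interchange x y ∣ u ∣ ∣ v ∣ ⟩
  (x ℕ.+ ∣ u ∣) ℕ.+ (y ℕ.+ ∣ v ∣)   ∎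
  where module +ℕ = CommutativeSemigroupProperties ℕP.+-commutativeSemigroup

∣0∣ : ∀ n → ∣ replicate n 0 ∣ ≡ 0
∣0∣ zero = refl
∣0∣ (suc n) = ∣0∣ n

deg-++ : ∀ {ℓ} (P Q : VComp ℓ) → deg (P ++ Q) ≡ deg P +ᵛ deg Q
deg-++ [] Q = sym (+ᵛ-identityˡ (deg Q))
deg-++ (a ∷ P) Q = trans (cong (proj₁ a +ᵛ_) (deg-++ P Q)) (sym (+ᵛ-assoc (proj₁ a) (deg P) (deg Q)))

deg-stuffle : ∀ {ℓ} (P Q : VComp ℓ) → All (λ W → deg W ≡ deg P +ᵛ deg Q) (stuffle P Q)
deg-stuffle [] Q = sym (+ᵛ-identityˡ (deg Q)) ∷ []
deg-stuffle (a ∷ u) [] = sym (+ᵛ-identityʳ (deg (a ∷ u))) ∷ []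
deg-stuffle {ℓ} (a ∷ u) (b ∷ v) =
  ++⁺ (map⁺ (All.map (λ e → trans (cong (A +ᵛ_) e) (sym (+ᵛ-assoc A (deg u) (B +ᵛ deg v)))) (deg-stuffle u (b ∷ v))))
  (++⁺ (map⁺ (All.map (λ e → trans (cong (B +ᵛ_) e) (+ᵛ.x∙yz≈y∙xz B (A +ᵛ deg u) (deg v))) (deg-stuffle (a ∷ u) v)))
       (map⁺ (All.map (λ e → trans (cong ((A +ᵛ B) +ᵛ_) e) (+ᵛ.interchange A B (deg u) (deg v))) (deg-stuffle u v))))
  where
  A B : Vec ℕ ℓ
  A = proj₁ a
  B = proj₁ b

sign-+ : ∀ m n → sign (m ℕ.+ n) ≡ sign m * sign n
sign-+ zero n = sym (*-identityˡ (sign n))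
sign-+ (suc m) n = trans (cong -_ (sign-+ m n)) (solve 2 (λ x y → :- (x :* y) := (:- x) :* y) refl (sign m) (sign n))

sign-sq : ∀ m → sign m * sign m ≡ 1ℚ
sign-sq zero = refl
sign-sq (suc m) = trans (solve 1 (λ x → (:- x) :* (:- x) := x :* x) refl (sign m)) (sign-sq m)

sign-+ᵛ : ∀ {n} (u v : Vec ℕ n) → sign ∣ u +ᵛ v ∣ ≡ sign ∣ u ∣ * sign ∣ v ∣
sign-+ᵛ u v = trans (cong sign (∣+ᵛ∣ u v)) (sign-+ ∣ u ∣ ∣ v ∣)

-- The sign twist φ ↦ φ̄ is an involutive automorphism of the convolution
-- monoid, since Δ preserves degree.
module _ {ℓ : ℕ} where

  private
    F : Set
    F = Functional ℓ

  bar-empty : (φ : F) → bar φ [] ≡ φ []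
  bar-empty φ = trans (cong (λ m → sign m * φ []) (∣0∣ ℓ)) (*-identityˡ (φ []))

  bar-bar : (φ : F) → bar (bar φ) ≗ φ
  bar-bar φ I = begin
    s * (s * φ I)   ≡⟨ solve 2 (λ s x → s :* (s :* x) := (s :* s) :* x) refl s (φ I) ⟩
    (s * s) * φ I   ≡⟨ cong (_* φ I) (sign-sq ∣ deg I ∣) ⟩
    1ℚ * φ I        ≡⟨ *-identityˡ (φ I) ⟩
    φ I             ∎
    where
    s : ℚ
    s = sign ∣ deg I ∣

  bar-⋆ : (φ ψ : F) → bar (φ ⋆ ψ) ≗ bar φ ⋆ bar ψ
  bar-⋆ φ ψ I = trans (sym (∑-*ˡ (sign ∣ deg I ∣) (deconcat I) (λ JK → φ (proj₁ JK) * ψ (proj₂ JK))))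
    (∑-congᴬ (All.map (λ {JK} → twist (proj₁ JK) (proj₂ JK)) (deconcat-splits I)))
    where
    twist : ∀ J K → J ++ K ≡ I → sign ∣ deg I ∣ * (φ J * ψ K) ≡ bar φ J * bar ψ K
    twist J K refl = begin
      sign ∣ deg (J ++ K) ∣ * (φ J * ψ K)        ≡⟨ cong (λ d → sign ∣ d ∣ * (φ J * ψ K)) (deg-++ J K) ⟩
      sign ∣ deg J +ᵛ deg K ∣ * (φ J * ψ K)      ≡⟨ cong (_* (φ J * ψ K)) (sign-+ᵛ (deg J) (deg K)) ⟩
      (sJ * sK) * (φ J * ψ K)                    ≡⟨ solve 4 (λ a b x y → (a :* b) :* (x :* y) := (a :* x) :* (b :* y)) refl sJ sK (φ J) (ψ K) ⟩
      (sJ * φ J) * (sK * ψ K)                    ∎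
      where
      sJ sK : ℚ
      sJ = sign ∣ deg J ∣
      sK = sign ∣ deg K ∣

module _ {ℓ : ℕ} where

  private
    F : Set
    F = Functional ℓ

  -- φ is multiplicative: φ(M_P M_Q) = φ(M_P) φ(M_Q), the product M_P M_Q
  -- being the sum of M_W over the quasi-shuffles W of P and Q.
  Multiplicative : F → Set
  Multiplicative φ = ∀ P Q → ∑ (stuffle P Q) φ ≡ φ P * φ Q

  ∑-stuffle : (φ : F) (a b : Letter ℓ) (u v : VComp ℓ) →
    ∑ (stuffle (a ∷ u) (b ∷ v)) φ
      ≡ ∑ (stuffle u (b ∷ v)) (∂ a φ) + (∑ (stuffle (a ∷ u) v) (∂ b φ) + ∑ (stuffle u v) (∂ (a ⊕ b) φ))
  ∑-stuffle φ a b u v = begin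
    ∑ (Wa ++ (Wb ++ Wab)) φ          ≡⟨ ∑-++ Wa (Wb ++ Wab) φ ⟩
    ∑ Wa φ + ∑ (Wb ++ Wab) φ         ≡⟨ cong (∑ Wa φ +_) (∑-++ Wb Wab φ) ⟩
    ∑ Wa φ + (∑ Wb φ + ∑ Wab φ)      ≡⟨ cong₂ _+_ (∑-map (a ∷_) (stuffle u (b ∷ v)) φ)
                                          (cong₂ _+_ (∑-map (b ∷_) (stuffle (a ∷ u) v) φ) (∑-map ((a ⊕ b) ∷_) (stuffle u v) φ)) ⟩
    ∑ (stuffle u (b ∷ v)) (∂ a φ) + (∑ (stuffle (a ∷ u) v) (∂ b φ) + ∑ (stuffle u v) (∂ (a ⊕ b) φ)) ∎
    where
    Wa Wb Wab : List (VComp ℓ)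
    Wa = L.map (a ∷_) (stuffle u (b ∷ v))
    Wb = L.map (b ∷_) (stuffle (a ∷ u) v)
    Wab = L.map ((a ⊕ b) ∷_) (stuffle u v)

  -- ε is multiplicative: a quasi-shuffle of two nonempty words is nonempty
  ε-multiplicative : Multiplicative ε
  ε-multiplicative [] Q = solve 1 (λ x → x :+ con 0ℚ := con 1ℚ :* x) refl (ε Q)
  ε-multiplicative (a ∷ u) [] = refl
  ε-multiplicative (a ∷ u) (b ∷ v) = trans (∑-stuffle ε a b u v)
    (cong₂ _+_ (∑-zero (stuffle u (b ∷ v)) (∂ a ε) (λ _ → refl))
      (cong₂ _+_ (∑-zero (stuffle (a ∷ u) v) (∂ b ε) (λ _ → refl)) (∑-zero (stuffle u v) (∂ (a ⊕ b) ε) (λ _ → refl))))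

  ∂ζ≗ε : (a : Letter ℓ) → ∂ a ζQ ≗ ε
  ∂ζ≗ε a [] = refl
  ∂ζ≗ε a (_ ∷ _) = refl

  -- ζQ is multiplicative: two nonempty words have a quasi-shuffle of length
  -- ≤ 1 only if they are single letters a and b, and then it is a ⊕ b
  ζ-multiplicative : Multiplicative ζQ
  ζ-multiplicative [] Q = solve 1 (λ x → x :+ con 0ℚ := con 1ℚ :* x) refl (ζQ Q)
  ζ-multiplicative (a ∷ u) [] = solve 1 (λ x → x :+ con 0ℚ := x :* con 1ℚ) refl (ζQ (a ∷ u))
  ζ-multiplicative (a ∷ u) (b ∷ v) = begin
    ∑ (stuffle (a ∷ u) (b ∷ v)) ζQ
      ≡⟨ ∑-stuffle ζQ a b u v ⟩
    ∑ (stuffle u (b ∷ v)) (∂ a ζQ) + (∑ (stuffle (a ∷ u) v) (∂ b ζQ) + ∑ (stuffle u v) (∂ (a ⊕ b) ζQ))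
      ≡⟨ cong₂ _+_ (∑-cong (stuffle u (b ∷ v)) (∂ζ≗ε a))
           (cong₂ _+_ (∑-cong (stuffle (a ∷ u) v) (∂ζ≗ε b)) (∑-cong (stuffle u v) (∂ζ≗ε (a ⊕ b)))) ⟩
    ∑ (stuffle u (b ∷ v)) ε + (∑ (stuffle (a ∷ u) v) ε + ∑ (stuffle u v) ε)
      ≡⟨ cong₂ _+_ (ε-multiplicative u (b ∷ v)) (cong₂ _+_ (ε-multiplicative (a ∷ u) v) (ε-multiplicative u v)) ⟩
    ε u * 0ℚ + (0ℚ * ε v + ε u * ε v)
      ≡⟨ solve 2 (λ x y → x :* con 0ℚ :+ (con 0ℚ :* y :+ x :* y) := x :* y) refl (ε u) (ε v) ⟩
    ε u * ε v
      ≡⟨ sym (cong₂ _*_ (∂ζ≗ε a u) (∂ζ≗ε b v)) ⟩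
    ζQ (a ∷ u) * ζQ (b ∷ v) ∎

  -- quasi-shuffling is homogeneous, so the sign twist preserves multiplicativity
  bar-multiplicative : (φ : F) → Multiplicative φ → Multiplicative (bar φ)
  bar-multiplicative φ mult P Q = begin
    ∑ (stuffle P Q) (bar φ)
      ≡⟨ ∑-congᴬ (All.map (λ {W} e → cong (λ d → sign ∣ d ∣ * φ W) e) (deg-stuffle P Q)) ⟩
    ∑ (stuffle P Q) (λ W → sign ∣ deg P +ᵛ deg Q ∣ * φ W)
      ≡⟨ ∑-*ˡ (sign ∣ deg P +ᵛ deg Q ∣) (stuffle P Q) φ ⟩
    sign ∣ deg P +ᵛ deg Q ∣ * ∑ (stuffle P Q) φ
      ≡⟨ cong₂ _*_ (sign-+ᵛ (deg P) (deg Q)) (mult P Q) ⟩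
    (sP * sQ) * (φ P * φ Q)
      ≡⟨ solve 4 (λ a b c d → (a :* b) :* (c :* d) := (a :* c) :* (b :* d)) refl sP sQ (φ P) (φ Q) ⟩
    bar φ P * bar φ Q ∎
    where
    sP sQ : ℚ
    sP = sign ∣ deg P ∣
    sQ = sign ∣ deg Q ∣

  eval-++ : (φ : F) (X Y : LinComb ℓ) → eval φ (X ++ Y) ≡ eval φ X + eval φ Y
  eval-++ φ X Y = ∑-++ X Y (λ cK → proj₁ cK * φ (proj₂ cK))

  eval-neg : (φ : F) (X : LinComb ℓ) → eval φ (negLC X) ≡ - eval φ X
  eval-neg φ [] = refl
  eval-neg φ ((c , K) ∷ X) = trans (cong ((- c) * φ K +_) (eval-neg φ X))
    (solve 3 (λ c x y → (:- c) :* x :+ (:- y) := :- (c :* x :+ y)) refl c (φ K) (eval φ X))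

  eval-mulM : (φ : F) → Multiplicative φ → ∀ P X → eval φ (mulM P X) ≡ φ P * eval φ X
  eval-mulM φ mult P [] = sym (*-zeroʳ (φ P))
  eval-mulM φ mult P ((c , K) ∷ X) = begin
      eval φ (cW ++ mulM P X)
    ≡⟨ eval-++ φ cW (mulM P X) ⟩
      eval φ cW + eval φ (mulM P X)
    ≡⟨ cong₂ _+_ (trans (∑-map (c ,_) (stuffle P K) (λ cW → proj₁ cW * φ (proj₂ cW)))
                  (trans (∑-*ˡ c (stuffle P K) φ) (cong (c *_) (mult P K)))) (eval-mulM φ mult P X) ⟩
      c * (φ P * φ K) + φ P * eval φ X
    ≡⟨ solve 4 (λ c p k e → c :* (p :* k) :+ p :* e := p :* (c :* k :+ e)) refl c (φ P) (φ K) (eval φ X) ⟩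
      φ P * eval φ ((c , K) ∷ X) ∎
    where
    cW : LinComb ℓ
    cW = L.map (c ,_) (stuffle P K)

  antipode-recursion : (χ : F) → Multiplicative χ → ∀ a r → (χ ∘S) (a ∷ r) ≡ - (∂ a χ ⋆ (χ ∘S)) r
  antipode-recursion χ mult a r = trans (eval-neg χ (antipodeAux [ a ] r))
    (cong -_ (splitting-sum χ (χ ∘S) (λ P q → eval χ (antipodeAux P q)) split-[] split-∷ [ a ] r))
    where
    split-[] : ∀ P → eval χ (antipodeAux P []) ≡ χ P * (χ ∘S) []
    split-[] P = eval-mulM χ mult P (antipode [])
    split-∷ : ∀ P b q → eval χ (antipodeAux P (b ∷ q)) ≡ χ P * (χ ∘S) (b ∷ q) + eval χ (antipodeAux (P ++ [ b ]) q)
    split-∷ P b q = trans (eval-++ χ (mulM P (antipode (b ∷ q))) (antipodeAux (P ++ [ b ]) q))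
      (cong (_+ eval χ (antipodeAux (P ++ [ b ]) q)) (eval-mulM χ mult P (antipode (b ∷ q))))

  character-inverse : (χ : F) → Multiplicative χ → χ [] ≡ 1ℚ → χ ⋆ (χ ∘S) ≗ ε
  character-inverse χ mult χ₀ = right-inverse-by-recursion χ (χ ∘S) χ₀
    (cong (λ x → 1ℚ * x + 0ℚ) χ₀) (antipode-recursion χ mult)

  Homogeneous : Vec ℕ ℓ → LinComb ℓ → Set
  Homogeneous d X = All (λ cK → deg (proj₂ cK) ≡ d) X

  mulM-homogeneous : ∀ P X d → Homogeneous d X → Homogeneous (deg P +ᵛ d) (mulM P X)
  mulM-homogeneous P [] d [] = []
  mulM-homogeneous P ((c , K) ∷ X) d (e ∷ es) =
    ++⁺ (map⁺ (All.map (λ e′ → trans e′ (cong (deg P +ᵛ_) e)) (deg-stuffle P K))) (mulM-homogeneous P X d es)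

  mutual
    antipode-homogeneous : ∀ I → Homogeneous (deg I) (antipode I)
    antipode-homogeneous [] = refl ∷ []
    antipode-homogeneous (a ∷ r) = map⁺ (All.map (λ e → trans e (sym (deg-++ [ a ] r))) (antipodeAux-homogeneous [ a ] r))

    antipodeAux-homogeneous : ∀ P r → Homogeneous (deg P +ᵛ deg r) (antipodeAux P r)
    antipodeAux-homogeneous P [] = mulM-homogeneous P (antipode []) (deg {ℓ} []) (antipode-homogeneous [])
    antipodeAux-homogeneous P (b ∷ q) = ++⁺
      (mulM-homogeneous P (antipode (b ∷ q)) (deg (b ∷ q)) (antipode-homogeneous (b ∷ q)))
      (All.map (λ e → trans e shift) (antipodeAux-homogeneous (P ++ [ b ]) q))
      where
      shift : deg (P ++ [ b ]) +ᵛ deg q ≡ deg P +ᵛ deg (b ∷ q)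
      shift = trans (sym (deg-++ (P ++ [ b ]) q)) (trans (cong deg (++-assoc P [ b ] q)) (deg-++ P (b ∷ q)))

  eval-congᴬ : {φ φ′ : F} (X : LinComb ℓ) → All (λ cK → φ (proj₂ cK) ≡ φ′ (proj₂ cK)) X → eval φ X ≡ eval φ′ X
  eval-congᴬ X es = ∑-congᴬ (All.map (λ {cK} e → cong (proj₁ cK *_) e) es)

  ∘S-cong : {φ φ′ : F} → φ ≗ φ′ → φ ∘S ≗ φ′ ∘S
  ∘S-cong φ≗φ′ I = eval-congᴬ (antipode I) (All.universal (λ cK → φ≗φ′ (proj₂ cK)) (antipode I))

  eval-bar : (φ : F) (d : Vec ℕ ℓ) (X : LinComb ℓ) → Homogeneous d X → eval (bar φ) X ≡ sign ∣ d ∣ * eval φ X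
  eval-bar φ d [] [] = solve 1 (λ s → con 0ℚ := s :* con 0ℚ) refl (sign ∣ d ∣)
  eval-bar φ d ((c , K) ∷ X) (e ∷ es) = trans (cong₂ (λ d′ y → c * (sign ∣ d′ ∣ * φ K) + y) e (eval-bar φ d X es))
    (solve 4 (λ c s x y → c :* (s :* x) :+ s :* y := s :* (c :* x :+ y)) refl c (sign ∣ d ∣) (φ K) (eval φ X))

  bar-∘S : (φ : F) → bar φ ∘S ≗ bar (φ ∘S)
  bar-∘S φ I = eval-bar φ (deg I) (antipode I) (antipode-homogeneous I)

module _ {ℓ : ℕ} where

  private
    F : Set
    F = Functional ℓ

  SplitClosed : (VComp ℓ → Set) → Set
  SplitClosed R = ∀ J K → R (J ++ K) → R J × R K

  AgreeOn : (VComp ℓ → Set) → F → F → Set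
  AgreeOn R φ ψ = ∀ I → R I → φ I ≡ ψ I

  ⋆-cong-on : {R : VComp ℓ → Set} → SplitClosed R → {φ φ′ ψ ψ′ : F} →
    AgreeOn R φ φ′ → AgreeOn R ψ ψ′ → AgreeOn R (φ ⋆ ψ) (φ′ ⋆ ψ′)
  ⋆-cong-on {R} closed {φ} {φ′} {ψ} {ψ′} φ≈φ′ ψ≈ψ′ I r =
    ∑-congᴬ (All.map (λ {JK} → agree (proj₁ JK) (proj₂ JK)) (deconcat-splits I))
    where
    agree : ∀ J K → J ++ K ≡ I → φ J * ψ K ≡ φ′ J * ψ′ K
    agree J K refl = cong₂ _*_ (φ≈φ′ J (proj₁ (closed J K r))) (ψ≈ψ′ K (proj₂ (closed J K r)))

  inverse-on : {R : VComp ℓ → Set} → SplitClosed R → {φ φ′ ψ θ : F} →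
    AgreeOn R φ φ′ → ψ ⋆ φ ≗ ε → φ′ ⋆ θ ≗ ε → AgreeOn R ψ θ
  inverse-on closed {φ} {φ′} {ψ} {θ} φ≈φ′ left right I r = begin
    ψ I                ≡⟨ sym (ε-unitʳ ψ I) ⟩
    (ψ ⋆ ε) I          ≡⟨ sym (⋆-congʳ ψ right I) ⟩
    (ψ ⋆ (φ′ ⋆ θ)) I   ≡⟨ sym (⋆-cong-on closed {ψ} {ψ} (λ _ _ → refl) (⋆-cong-on closed {ψ = θ} {θ} φ≈φ′ (λ _ _ → refl)) I r) ⟩
    (ψ ⋆ (φ ⋆ θ)) I    ≡⟨ sym (⋆-assoc ψ φ θ I) ⟩
    ((ψ ⋆ φ) ⋆ θ) I    ≡⟨ ⋆-congˡ θ left I ⟩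
    (ε ⋆ θ) I          ≡⟨ ε-unitˡ θ I ⟩
    θ I                ∎

Below : ∀ {ℓ} → Vec ℕ∞ ℓ → VComp ℓ → Set
Below k I = deg I ≤ᵛ k

split-≤∞ : ∀ m n k → (m ℕ.+ n) ≤∞ k → m ≤∞ k × n ≤∞ k
split-≤∞ m n (fin x) (fin≤ m+n≤x) = fin≤ (ℕP.m+n≤o⇒m≤o m m+n≤x) , fin≤ (ℕP.m+n≤o⇒n≤o m m+n≤x)
split-≤∞ m n ∞ ≤∞∞ = ≤∞∞ , ≤∞∞

split-≤ᵛ : ∀ {n} (u v : Vec ℕ n) (k : Vec ℕ∞ n) → (u +ᵛ v) ≤ᵛ k → u ≤ᵛ k × v ≤ᵛ k
split-≤ᵛ V.[] V.[] V.[] PW.[] = PW.[] , PW.[]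
split-≤ᵛ (x V.∷ u) (y V.∷ v) (c V.∷ k) (x+y≤c PW.∷ u+v≤k) =
  (proj₁ (split-≤∞ x y c x+y≤c) PW.∷ proj₁ (split-≤ᵛ u v k u+v≤k)) ,
  (proj₂ (split-≤∞ x y c x+y≤c) PW.∷ proj₂ (split-≤ᵛ u v k u+v≤k))

below-split-closed : ∀ {ℓ} (k : Vec ℕ∞ ℓ) → SplitClosed (Below k)
below-split-closed k J K JK≤k = split-≤ᵛ (deg J) (deg K) k (subst (_≤ᵛ k) (deg-++ J K) JK≤k)

module _ {ℓ : ℕ} (k : Vec ℕ∞ ℓ) where

  -- since S is homogeneous, φ ∘ S below k only depends on φ below k
  ∘S-cong-below : {φ φ′ : Functional ℓ} → AgreeOn (Below k) φ φ′ → AgreeOn (Below k) (φ ∘S) (φ′ ∘S)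
  ∘S-cong-below φ≈φ′ I I≤k = eval-congᴬ (antipode I)
    (All.map (λ {cK} e → φ≈φ′ (proj₂ cK) (subst (_≤ᵛ k) (sym e) I≤k)) (antipode-homogeneous I))

  ζ^k≈ζ̄ : AgreeOn (Below k) (ζQ^ k) (bar ζQ)
  ζ^k≈ζ̄ K K≤k with deg K ≤ᵛ? k
  ... | yes _ = refl
  ... | no K≰k = ⊥-elim (K≰k K≤k)

  ζ^k-empty : ζQ^ k [] ≡ 1ℚ
  ζ^k-empty with deg {ℓ} [] ≤ᵛ? k
  ... | yes _ = bar-empty {ℓ} ζQ
  ... | no _ = refl

proposition6p1 : (ℓ : ℕ) → 1 ℕ.≤ ℓ → (k : Vec ℕ∞ ℓ) → IsOdd k (νQ^ k)
proposition6p1 ℓ _ k = inv ν , inv-inverse ν ν-unit , odd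
  where
  ν ζ̄ ν∞ θ : Functional ℓ
  ν = νQ^ k
  ζ̄ = bar ζQ
  ν∞ = (ζ̄ ∘S) ⋆ ζQ
  θ = (ζQ ∘S) ⋆ ζ̄

  ν-unit : ν [] ≡ 1ℚ
  ν-unit = cong (λ x → (1ℚ * x + 0ℚ) * 1ℚ + 0ℚ) (ζ^k-empty k)

  ν≈ν∞ : AgreeOn (Below k) ν ν∞
  ν≈ν∞ = ⋆-cong-on (below-split-closed k) (∘S-cong-below k (ζ^k≈ζ̄ k)) (λ _ _ → refl)

  ζ̄-unit : ζ̄ [] ≡ 1ℚ
  ζ̄-unit = bar-empty {ℓ} ζQ

  ζ̄∘S⋆ζ̄ : (ζ̄ ∘S) ⋆ ζ̄ ≗ ε
  ζ̄∘S⋆ζ̄ = right-inverse⇒left ζ̄ (ζ̄ ∘S) ζ̄-unit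
    (character-inverse ζ̄ (bar-multiplicative ζQ ζ-multiplicative) ζ̄-unit)

  ν∞⋆θ : ν∞ ⋆ θ ≗ ε
  ν∞⋆θ = ⋆-right-inverse ζQ (ζQ ∘S) (ζ̄ ∘S) ζ̄ (character-inverse ζQ ζ-multiplicative refl) ζ̄∘S⋆ζ̄

  ν̄∞≗θ : bar ν∞ ≗ θ
  ν̄∞≗θ I = trans (bar-⋆ (ζ̄ ∘S) ζQ I)
    (⋆-congˡ ζ̄ (λ J → trans (sym (bar-∘S ζ̄ J)) (∘S-cong (bar-bar ζQ) J)) I)

  odd : ∀ I → deg I ≤ᵛ k → bar ν I ≡ inv ν I
  odd I I≤k = begin
    bar ν I    ≡⟨ cong (sign ∣ deg I ∣ *_) (ν≈ν∞ I I≤k) ⟩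
    bar ν∞ I   ≡⟨ ν̄∞≗θ I ⟩
    θ I        ≡⟨ sym (inverse-on (below-split-closed k) {ν} {ν∞} {inv ν} {θ} ν≈ν∞ (inv-left ν ν-unit) ν∞⋆θ I I≤k) ⟩
    inv ν I    ∎
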